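{- Let $G_B=(V_B,E_B)$ be a graph with $n=|V_B|$ even, and let $G=(V,E)$ be the graph obtained from $G_B$ by adding a set $V_c$ of $n$ new vertices forming a clique and joining every vertex of $V_B$ to every vertex of $V_c$ (so $V=V_c\cup V_B$). Let $G_1=G[V_1]$, $G_2=G[V_2]$ be a feasible solution of {\sf 2-Overlapping Densest Subgraphs} on $G$ with $\alpha=\frac23$ such that $V_c\subseteq V_1$, $V_c\subseteq V_2$ and $V_1\cup V_2=V$. Then $V_1\cap V_2=V_c$ and $|V_1|=|V_2|$.
   Context: Graphs are finite, simple, undirected; density of a graph with $n'\ge1$ vertices and $m'$ edges is $m'/n'$. A feasible solution of {\sf 2-Overlapping Densest Subgraphs} on $G$ with parameter $\alpha$ is a pair of induced subgraphs $G[V_1]$, $G[V_2]$ with $V_1,V_2$ nonempty, $V_1\neq V_2$, $|V_1\cap V_2|\le\alpha|V_1|$ and $|V_1\cap V_2|\le\alpha|V_2|$. -}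

module Defs where

open import Data.Nat using (ℕ; _*_; _≤_; _+_)
open import Data.Fin using (Fin; splitAt)
open import Data.Fin.Subset using (Subset; _∩_; ∣_∣; Nonempty; inside; outside)
open import Data.Sum using (_⊎_; inj₁; inj₂)
open import Data.Unit using (⊤)
import Data.Bool
open import Data.Product using (_×_)
open import Data.Vec using (tabulate)
open import Relation.Binary.PropositionalEquality using (_≡_; _≢_)
open import Relation.Nullary using (¬_)
open import Level using (0ℓ)

record Graph (m : ℕ) : Set₁ where
  field
    Adj   : Fin m → Fin m → Set
    sym   : ∀ {x y} → Adj x y → Adj y x
    irrefl : ∀ {x} → ¬ Adj x x
open Graph public

-- The construction of the paper: G has vertex set Fin (n + n); the first n
-- vertices (via splitAt n) form V_c, the last n are the vertices of G_B.
cAdj : ∀ {n} → Graph n → Fin n ⊎ Fin n → Fin n ⊎ Fin n → Set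
cAdj GB (inj₁ x) (inj₁ y) = x ≢ y
cAdj GB (inj₁ x) (inj₂ y) = ⊤
cAdj GB (inj₂ x) (inj₁ y) = ⊤
cAdj GB (inj₂ x) (inj₂ y) = Adj GB x y

cAdj-sym : ∀ {n} (GB : Graph n) {x y} → cAdj GB x y → cAdj GB y x
cAdj-sym GB {inj₁ x} {inj₁ y} p = λ e → p (Relation.Binary.PropositionalEquality.sym e)
cAdj-sym GB {inj₁ x} {inj₂ y} p = _
cAdj-sym GB {inj₂ x} {inj₁ y} p = _
cAdj-sym GB {inj₂ x} {inj₂ y} p = Graph.sym GB p

cAdj-irrefl : ∀ {n} (GB : Graph n) {x} → ¬ cAdj GB x x
cAdj-irrefl GB {inj₁ x} p = p Relation.Binary.PropositionalEquality.refl
cAdj-irrefl GB {inj₂ x} p = Graph.irrefl GB p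

addClique : ∀ {n} → Graph n → Graph (n + n)
addClique {n} GB = record
  { Adj    = λ x y → cAdj GB (splitAt n x) (splitAt n y)
  ; sym    = λ {x} {y} → cAdj-sym GB {splitAt n x} {splitAt n y}
  ; irrefl = λ {x} → cAdj-irrefl GB {splitAt n x}
  }

isC : ∀ {n} → Fin n ⊎ Fin n → Data.Bool.Bool
isC (inj₁ _) = inside
isC (inj₂ _) = outside

Vc : ∀ n → Subset (n + n)
Vc n = tabulate (λ i → isC (splitAt n i))

-- Feasible solution of 2-Overlapping Densest Subgraphs on G with
-- α = p / q (q ≠ 0): the pair of induced subgraphs G[V₁], G[V₂] is given by
-- the vertex sets V₁, V₂ (the graph G is kept as a parameter).
-- |V₁ ∩ V₂| ≤ (p/q)|Vᵢ|  is written  q * |V₁ ∩ V₂| ≤ p * |Vᵢ|.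
record Feasible {m : ℕ} (G : Graph m) (p q : ℕ) (V₁ V₂ : Subset m) : Set where
  field
    nonempty₁ : Nonempty V₁
    nonempty₂ : Nonempty V₂
    distinct  : V₁ ≢ V₂
    overlap₁  : q * ∣ V₁ ∩ V₂ ∣ ≤ p * ∣ V₁ ∣
    overlap₂  : q * ∣ V₁ ∩ V₂ ∣ ≤ p * ∣ V₂ ∣

-- Put c = |V₁ ∩ V₂|. Since V_c lies in both sets, c ≥ n, and inclusion–exclusion
-- with V₁ ∪ V₂ = V gives |V₁| + |V₂| = c + 2n. Adding the two overlap constraints
-- 3c ≤ 2|Vᵢ| yields 3c ≤ c + 2n, so c ≤ n; hence c = n and V₁ ∩ V₂ = V_c.
-- Now |V₁| + |V₂| = 3c while each 2|Vᵢ| ≥ 3c, which forces |V₁| = |V₂|.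
module Submission where

open import Defs using (Graph; addClique; Feasible; Vc; isC)
open import Data.Nat using (ℕ; _*_; _+_; _≤_; suc; s≤s)
open import Data.Nat.Properties
  using (≤-antisym; ≤-trans; ≤-reflexive; <-irrefl; +-suc; +-identityʳ; +-mono-≤; +-comm;
         +-cancelˡ-≤; *-cancelˡ-≤; *-distribˡ-+; module ≤-Reasoning)
open import Data.Product using (∃-syntax; _×_; _,_; proj₁; proj₂)
open import Data.Fin using (splitAt)
open import Data.Sum using (inj₁; inj₂; [_,_]′)
open import Data.Vec using ([]; _∷_; _++_; lookup; tabulate; here)
open import Data.Vec.Properties using (tabulate-cong; tabulate∘lookup; lookup-splitAt; lookup-replicate)
open import Data.Fin.Subset using (Subset; _⊆_; _∩_; _∪_; ⊤; ⊥; ∣_∣; inside; outside)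
open import Data.Fin.Subset.Properties using (∣⊤∣≡n; ∣⊥∣≡0; drop-∷-⊆; p⊆q⇒∣p∣≤∣q∣; x∈p∩q⁺)
open import Relation.Binary.PropositionalEquality
  using (_≡_; refl; sym; trans; cong; cong₂; subst; module ≡-Reasoning)

∣p++q∣≡∣p∣+∣q∣ : ∀ {m n} (p : Subset m) (q : Subset n) → ∣ p ++ q ∣ ≡ ∣ p ∣ + ∣ q ∣
∣p++q∣≡∣p∣+∣q∣ []            q = refl
∣p++q∣≡∣p∣+∣q∣ (inside ∷ p)  q = cong suc (∣p++q∣≡∣p∣+∣q∣ p q)
∣p++q∣≡∣p∣+∣q∣ (outside ∷ p) q = ∣p++q∣≡∣p∣+∣q∣ p q

∣p∩q∣+∣p∪q∣≡∣p∣+∣q∣ : ∀ {m} (p q : Subset m) → ∣ p ∩ q ∣ + ∣ p ∪ q ∣ ≡ ∣ p ∣ + ∣ q ∣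
∣p∩q∣+∣p∪q∣≡∣p∣+∣q∣ []            []            = refl
∣p∩q∣+∣p∪q∣≡∣p∣+∣q∣ (inside ∷ p)  (inside ∷ q)  =
  cong suc (trans (+-suc _ _) (trans (cong suc (∣p∩q∣+∣p∪q∣≡∣p∣+∣q∣ p q)) (sym (+-suc _ _))))
∣p∩q∣+∣p∪q∣≡∣p∣+∣q∣ (inside ∷ p)  (outside ∷ q) = trans (+-suc _ _) (cong suc (∣p∩q∣+∣p∪q∣≡∣p∣+∣q∣ p q))
∣p∩q∣+∣p∪q∣≡∣p∣+∣q∣ (outside ∷ p) (inside ∷ q)  =
  trans (+-suc _ _) (trans (cong suc (∣p∩q∣+∣p∪q∣≡∣p∣+∣q∣ p q)) (sym (+-suc _ _)))
∣p∩q∣+∣p∪q∣≡∣p∣+∣q∣ (outside ∷ p) (outside ∷ q) = ∣p∩q∣+∣p∪q∣≡∣p∣+∣q∣ p q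

p⊆q∧∣q∣≤∣p∣⇒p≡q : ∀ {m} {p q : Subset m} → p ⊆ q → ∣ q ∣ ≤ ∣ p ∣ → p ≡ q
p⊆q∧∣q∣≤∣p∣⇒p≡q {p = []}          {[]}          _   _ = refl
p⊆q∧∣q∣≤∣p∣⇒p≡q {p = outside ∷ p} {outside ∷ q} p⊆q ∣q∣≤∣p∣ =
  cong (outside ∷_) (p⊆q∧∣q∣≤∣p∣⇒p≡q (drop-∷-⊆ p⊆q) ∣q∣≤∣p∣)
p⊆q∧∣q∣≤∣p∣⇒p≡q {p = outside ∷ p} {inside ∷ q}  p⊆q ∣q∣≤∣p∣ with
  () ← <-irrefl refl (≤-trans ∣q∣≤∣p∣ (p⊆q⇒∣p∣≤∣q∣ (drop-∷-⊆ p⊆q)))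
p⊆q∧∣q∣≤∣p∣⇒p≡q {p = inside ∷ p}  {outside ∷ q} p⊆q _ with () ← p⊆q here
p⊆q∧∣q∣≤∣p∣⇒p≡q {p = inside ∷ p}  {inside ∷ q}  p⊆q (s≤s ∣q∣≤∣p∣) =
  cong (inside ∷_) (p⊆q∧∣q∣≤∣p∣⇒p≡q (drop-∷-⊆ p⊆q) ∣q∣≤∣p∣)

Vc≡⊤++⊥ : ∀ n → Vc n ≡ ⊤ {n} ++ ⊥ {n}
Vc≡⊤++⊥ n = begin
  tabulate (λ i → isC (splitAt n i))                      ≡⟨ tabulate-cong (λ i → isC≡lookup (splitAt n i)) ⟩
  tabulate (λ i → [ lookup ⊤ₙ , lookup ⊥ₙ ]′ (splitAt n i)) ≡⟨ tabulate-cong (λ i → sym (lookup-splitAt n ⊤ₙ ⊥ₙ i)) ⟩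
  tabulate (lookup (⊤ₙ ++ ⊥ₙ))                              ≡⟨ tabulate∘lookup (⊤ₙ ++ ⊥ₙ) ⟩
  ⊤ₙ ++ ⊥ₙ                                                   ∎
  where
  open ≡-Reasoning
  ⊤ₙ ⊥ₙ : Subset n
  ⊤ₙ = ⊤
  ⊥ₙ = ⊥
  isC≡lookup : ∀ x → isC x ≡ [ lookup ⊤ₙ , lookup ⊥ₙ ]′ x
  isC≡lookup (inj₁ i) = sym (lookup-replicate i inside)
  isC≡lookup (inj₂ i) = sym (lookup-replicate i outside)

∣Vc∣≡n : ∀ n → ∣ Vc n ∣ ≡ n
∣Vc∣≡n n = begin
  ∣ Vc n ∣                 ≡⟨ cong ∣_∣ (Vc≡⊤++⊥ n) ⟩
  ∣ ⊤ {n} ++ ⊥ {n} ∣       ≡⟨ ∣p++q∣≡∣p∣+∣q∣ (⊤ {n}) (⊥ {n}) ⟩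
  ∣ ⊤ {n} ∣ + ∣ ⊥ {n} ∣    ≡⟨ cong₂ _+_ (∣⊤∣≡n n) (∣⊥∣≡0 n) ⟩
  n + 0                    ≡⟨ +-identityʳ n ⟩
  n                        ∎
  where open ≡-Reasoning

3m≤2a∧3m≤2b⇒3m≤a+b : ∀ {m a b} → 3 * m ≤ 2 * a → 3 * m ≤ 2 * b → 3 * m ≤ a + b
3m≤2a∧3m≤2b⇒3m≤a+b {m} {a} {b} 3m≤2a 3m≤2b = *-cancelˡ-≤ 2 (begin
  2 * (3 * m)   ≡⟨ cong (3 * m +_) (+-identityʳ (3 * m)) ⟩
  3 * m + 3 * m ≤⟨ +-mono-≤ 3m≤2a 3m≤2b ⟩
  2 * a + 2 * b ≡⟨ sym (*-distribˡ-+ 2 a b) ⟩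
  2 * (a + b)   ∎)
  where open ≤-Reasoning

3m≤m+2n⇒m≤n : ∀ {m n} → 3 * m ≤ m + (n + n) → m ≤ n
3m≤m+2n⇒m≤n {m} {n} 3m≤m+2n = *-cancelˡ-≤ 2 (begin
  2 * m   ≤⟨ +-cancelˡ-≤ m (2 * m) (n + n) 3m≤m+2n ⟩
  n + n   ≡⟨ cong (n +_) (sym (+-identityʳ n)) ⟩
  2 * n   ∎)
  where open ≤-Reasoning

a+b≤2a⇒b≤a : ∀ {a b} → a + b ≤ 2 * a → b ≤ a
a+b≤2a⇒b≤a {a} {b} a+b≤2a = +-cancelˡ-≤ a b a (subst (a + b ≤_) (cong (a +_) (+-identityʳ a)) a+b≤2a)

3n≤2a∧3n≤2b⇒a≡b : ∀ {n a b} → n + (n + n) ≡ a + b → 3 * n ≤ 2 * a → 3 * n ≤ 2 * b → a ≡ b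
3n≤2a∧3n≤2b⇒a≡b {n} {a} {b} n+2n≡a+b 3n≤2a 3n≤2b = ≤-antisym
  (a+b≤2a⇒b≤a {b} {a} (subst (_≤ 2 * b) (trans n+2n≡a+b (+-comm a b)) (subst (_≤ 2 * b) 3*n≡n+2n 3n≤2b)))
  (a+b≤2a⇒b≤a {a} {b} (subst (_≤ 2 * a) n+2n≡a+b (subst (_≤ 2 * a) 3*n≡n+2n 3n≤2a)))
  where
  3*n≡n+2n : 3 * n ≡ n + (n + n)
  3*n≡n+2n = cong (λ k → n + (n + k)) (+-identityʳ n)

c+2n≡a+b∧3c≤2a∧3c≤2b⇒c≤n : ∀ {c n a b} → c + (n + n) ≡ a + b → 3 * c ≤ 2 * a → 3 * c ≤ 2 * b → c ≤ n
c+2n≡a+b∧3c≤2a∧3c≤2b⇒c≤n {c} {n} {a} {b} c+2n≡a+b 3c≤2a 3c≤2b =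
  3m≤m+2n⇒m≤n (subst (3 * c ≤_) (sym c+2n≡a+b) (3m≤2a∧3m≤2b⇒3m≤a+b {c} {a} {b} 3c≤2a 3c≤2b))

n≤c∧3c≤2a∧3c≤2b⇒c≡n∧a≡b : ∀ {c n a b} → n ≤ c → c + (n + n) ≡ a + b →
                            3 * c ≤ 2 * a → 3 * c ≤ 2 * b → c ≡ n × a ≡ b
n≤c∧3c≤2a∧3c≤2b⇒c≡n∧a≡b {c} {n} {a} {b} n≤c c+2n≡a+b 3c≤2a 3c≤2b
  with refl ← ≤-antisym (c+2n≡a+b∧3c≤2a∧3c≤2b⇒c≤n {c} {n} {a} {b} c+2n≡a+b 3c≤2a 3c≤2b) n≤c =
  refl , 3n≤2a∧3n≤2b⇒a≡b {c} {a} {b} c+2n≡a+b 3c≤2a 3c≤2b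

lemma20 : (n : ℕ) → ∃[ k ] n ≡ 2 * k → (GB : Graph n) → (V₁ V₂ : Subset (n + n)) →
            Feasible (addClique GB) 2 3 V₁ V₂ → Vc n ⊆ V₁ → Vc n ⊆ V₂ → V₁ ∪ V₂ ≡ ⊤ →
            (V₁ ∩ V₂ ≡ Vc n) × (∣ V₁ ∣ ≡ ∣ V₂ ∣)
lemma20 n _ _ V₁ V₂ feasible Vc⊆V₁ Vc⊆V₂ V₁∪V₂≡⊤ =
  sym (p⊆q∧∣q∣≤∣p∣⇒p≡q Vc⊆V₁∩V₂ (≤-reflexive (trans ∣V₁∩V₂∣≡n (sym (∣Vc∣≡n n))))) , ∣V₁∣≡∣V₂∣
  where
  open Feasible feasible

  Vc⊆V₁∩V₂ : Vc n ⊆ V₁ ∩ V₂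
  Vc⊆V₁∩V₂ x∈Vc = x∈p∩q⁺ (Vc⊆V₁ x∈Vc , Vc⊆V₂ x∈Vc)

  n≤∣V₁∩V₂∣ : n ≤ ∣ V₁ ∩ V₂ ∣
  n≤∣V₁∩V₂∣ = subst (_≤ ∣ V₁ ∩ V₂ ∣) (∣Vc∣≡n n) (p⊆q⇒∣p∣≤∣q∣ Vc⊆V₁∩V₂)

  ∣V₁∩V₂∣+2n≡∣V₁∣+∣V₂∣ : ∣ V₁ ∩ V₂ ∣ + (n + n) ≡ ∣ V₁ ∣ + ∣ V₂ ∣
  ∣V₁∩V₂∣+2n≡∣V₁∣+∣V₂∣ = begin
    ∣ V₁ ∩ V₂ ∣ + (n + n)       ≡⟨ cong (∣ V₁ ∩ V₂ ∣ +_) (sym (∣⊤∣≡n (n + n))) ⟩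
    ∣ V₁ ∩ V₂ ∣ + ∣ ⊤ {n + n} ∣ ≡⟨ cong (λ V → ∣ V₁ ∩ V₂ ∣ + ∣ V ∣) (sym V₁∪V₂≡⊤) ⟩
    ∣ V₁ ∩ V₂ ∣ + ∣ V₁ ∪ V₂ ∣   ≡⟨ ∣p∩q∣+∣p∪q∣≡∣p∣+∣q∣ V₁ V₂ ⟩
    ∣ V₁ ∣ + ∣ V₂ ∣             ∎
    where open ≡-Reasoning

  ∣V₁∩V₂∣≡n∧∣V₁∣≡∣V₂∣ : ∣ V₁ ∩ V₂ ∣ ≡ n × ∣ V₁ ∣ ≡ ∣ V₂ ∣
  ∣V₁∩V₂∣≡n∧∣V₁∣≡∣V₂∣ = n≤c∧3c≤2a∧3c≤2b⇒c≡n∧a≡b n≤∣V₁∩V₂∣ ∣V₁∩V₂∣+2n≡∣V₁∣+∣V₂∣ overlap₁ overlap₂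

  ∣V₁∩V₂∣≡n : ∣ V₁ ∩ V₂ ∣ ≡ n
  ∣V₁∩V₂∣≡n = proj₁ ∣V₁∩V₂∣≡n∧∣V₁∣≡∣V₂∣

  ∣V₁∣≡∣V₂∣ : ∣ V₁ ∣ ≡ ∣ V₂ ∣
  ∣V₁∣≡∣V₂∣ = proj₂ ∣V₁∩V₂∣≡n∧∣V₁∣≡∣V₂∣
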